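{- Let $G$ be a graph of order $n$ and size $m$. Then \[K_{\max}(S(G))\le 2\left[\binom{n+m}{2}-\binom{n}{2}\right]+K_{\max}(G),\] with equality if there is an optimal orientation of $G$ that is strong.
   Context: Graphs are finite and simple. The subdivision $S(G)$ has vertex set $V(G)\cup E(G)$, with $u\in V(G)$ adjacent to $e\in E(G)$ exactly when $u$ is an endvertex of $e$. An orientation of a graph is obtained by directing each edge. For a digraph $D$ and distinct vertices $u,v$, $\kappa_D(u,v)$ is the maximum number of internally disjoint directed $u$--$v$ paths; the total connectivity $K(D)$ is the sum of $\kappa_D(u,v)$ over all ordered pairs of distinct vertices. $K_{\max}(H)$ is the maximum of $K(D)$ over all orientations $D$ of $H$; an orientation attaining it is optimal. An orientation is strong if there is a directed path between every ordered pair of distinct vertices. -}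

module Defs where

open import Data.Nat using (ℕ; _+_; _≤_)
open import Data.Bool using (Bool; true; false; if_then_else_)
open import Data.Fin using (Fin; _≟_; splitAt; _↑ˡ_; _↑ʳ_)
open import Data.Sum using (_⊎_; inj₁; inj₂)
open import Data.Product using (_×_; _,_; proj₁; proj₂; ∃-syntax)
open import Data.List using (List; []; _∷_; _++_; [_]; length; map; allFin)
open import Data.Nat.ListAction using (sum)
open import Data.List.Relation.Unary.All using (All)
open import Data.List.Relation.Unary.AllPairs using (AllPairs)
open import Data.List.Relation.Unary.Linked using (Linked)
open import Data.List.Relation.Unary.Unique.Propositional using (Unique)
open import Data.List.Relation.Binary.Disjoint.Propositional using (Disjoint)
open import Relation.Binary.PropositionalEquality using (_≡_; _≢_)
open import Relation.Nullary.Decidable using (⌊_⌋)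

record Graph : Set where
  field
    n : ℕ
    m : ℕ
    ends : Fin m → Fin n × Fin n
open Graph public

SameEdge : ∀ {k} → Fin k × Fin k → Fin k × Fin k → Set
SameEdge (a , b) (c , d) = (a ≡ c × b ≡ d) ⊎ (a ≡ d × b ≡ c)

Simple : Graph → Set
Simple G = (∀ e → proj₁ (ends G e) ≢ proj₂ (ends G e))
         × (∀ e f → SameEdge (ends G e) (ends G f) → e ≡ f)

-- Subdivision S(G): vertices Fin (n + m) (first the vertices of G, then
-- one vertex per edge of G); edges Fin (m + m): for each edge e = uv of G
-- the edge u–e (first copy) and the edge v–e (second copy).
S : Graph → Graph
S G = record
  { n = n G + m G
  ; m = m G + m G
  ; ends = λ i → sub (splitAt (m G) i)
  }
  where
  sub : Fin (m G) ⊎ Fin (m G) → Fin (n G + m G) × Fin (n G + m G)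
  sub (inj₁ e) = proj₁ (ends G e) ↑ˡ m G , n G ↑ʳ e
  sub (inj₂ e) = proj₂ (ends G e) ↑ˡ m G , n G ↑ʳ e

record Digraph : Set₁ where
  field
    N : ℕ
    Arc : Fin N → Fin N → Set
open Digraph public

-- An orientation of G: for each edge, true = directed from first to
-- second endvertex, false = the reverse.
Orientation : Graph → Set
Orientation G = Fin (m G) → Bool

orient : (G : Graph) → Orientation G → Digraph
orient G d = record
  { N = n G
  ; Arc = λ u v → ∃[ e ] ((ends G e ≡ (u , v) × d e ≡ true)
                          ⊎ (ends G e ≡ (v , u) × d e ≡ false))
  }

-- A directed u–v path, given by its list of internal vertices `is`:
-- the vertex sequence u ∷ is ++ [ v ] has no repetition and consecutive
-- vertices are joined by arcs.
IsPath : (D : Digraph) → Fin (N D) → Fin (N D) → List (Fin (N D)) → Set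
IsPath D u v is = Unique (u ∷ is ++ [ v ]) × Linked (Arc D) (u ∷ is ++ [ v ])

IDFamily : (D : Digraph) → Fin (N D) → Fin (N D) → List (List (Fin (N D))) → Set
IDFamily D u v ps =
  All (IsPath D u v) ps × AllPairs (λ p q → p ≢ q × Disjoint p q) ps

IsKappa : (D : Digraph) → Fin (N D) → Fin (N D) → ℕ → Set
IsKappa D u v k =
  (∃[ ps ] (IDFamily D u v ps × length ps ≡ k))
  × (∀ ps → IDFamily D u v ps → length ps ≤ k)

sumPairs : (N : ℕ) → (Fin N → Fin N → ℕ) → ℕ
sumPairs N f = sum (map (λ u → sum (map (λ v → if ⌊ u ≟ v ⌋ then 0 else f u v)
                                         (allFin N)))
                        (allFin N))

IsTotal : Digraph → ℕ → Set
IsTotal D t = ∃[ κ ] ((∀ u v → u ≢ v → IsKappa D u v (κ u v)) × t ≡ sumPairs (N D) κ)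

OptimalWith : (G : Graph) → Orientation G → ℕ → Set
OptimalWith G d t = IsTotal (orient G d) t
  × (∀ d' t' → IsTotal (orient G d') t' → t' ≤ t)

Optimal : (G : Graph) → Orientation G → Set
Optimal G d = ∃[ t ] OptimalWith G d t

IsKmax : Graph → ℕ → Set
IsKmax G t = ∃[ d ] OptimalWith G d t

Strong : Digraph → Set
Strong D = ∀ u v → u ≢ v → ∃[ is ] IsPath D u v is

{-# OPTIONS --safe #-}
-- Split V(S(G)) into the original vertices and the midpoints of the edges. A midpoint
-- has degree 2, so in any orientation κ(e, y) + κ(y, e) ≤ 2: the pairs involving a
-- midpoint contribute at most 2nm + m(m − 1) = 2[C(n+m,2) − C(n,2)]. Between original
-- vertices, a directed path of S(G) crosses each midpoint from one end of its edge to
-- the other, so orienting every edge of G like its first half turns it into a path of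
-- G; internally disjoint paths stay internally disjoint (simplicity rules out two
-- one-edge paths along parallel edges), so this part is at most K of an orientation of
-- G, hence at most K_max(G). Conversely, subdividing an orientation D of G lifts paths
-- back and preserves κ between original vertices; if D is strong, every midpoint
-- reaches and is reached from every other vertex, so all pairs involving a midpoint
-- have κ = 1 and K(S(D)) = 2[C(n+m,2) − C(n,2)] + K(D).

module Submission where

open import Defs
open import Data.Nat using (ℕ; zero; suc; z≤n; s≤s; _+_; _*_; _∸_; _≤_)
open import Data.Nat.Properties as ℕ using ()
import Data.Nat.ListAction as ListAction
open import Data.Nat.Combinatorics using (_C_; nC1≡n; nCk+nC[k+1]≡[n+1]C[k+1])
open import Data.Nat.Tactic.RingSolver using (solve-∀)
open import Data.Bool using (Bool; true; false; not; if_then_else_)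
import Data.Bool.Properties as Boolₚ
open import Data.Fin as Fin using (Fin; _≟_; _↑ˡ_; _↑ʳ_)
open import Data.Fin.Properties as Finₚ using ()
open import Data.Sum using (_⊎_; inj₁; inj₂; [_,_]′)
open import Data.Product using (_×_; _,_; proj₁; proj₂; ∃; ∃-syntax)
open import Data.Product.Properties as Productₚ using (,-injective)
open import Data.List using (List; []; _∷_; _++_; [_]; length; map; allFin; tabulate; cartesianProductWith)
open import Data.List.Properties as Listₚ using ()
open import Data.List.Relation.Unary.All as All using (All; []; _∷_)
import Data.List.Relation.Unary.All.Properties as Allₚ
open import Data.List.Relation.Unary.Any as Any using (here; there)
open import Data.List.Relation.Unary.AllPairs as AllPairs using (AllPairs; []; _∷_)
import Data.List.Relation.Unary.AllPairs.Properties as AllPairsₚ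
open import Data.List.Relation.Unary.Linked as Linked using (Linked; []; [-]; _∷_)
open import Data.List.Relation.Unary.Unique.Propositional using (Unique)
import Data.List.Relation.Unary.Unique.Propositional.Properties as Uniqueₚ
open import Data.List.Relation.Binary.Disjoint.Propositional using (Disjoint)
open import Data.List.Membership.Propositional using (_∈_; _∉_; find; lose)
open import Data.List.Membership.Propositional.Properties
  using (∈-allFin; ∈-∃++; ∈-++⁺ˡ; ∈-++⁺ʳ; ∈-++⁻; ∈-cartesianProductWith⁺)
open import Data.Empty using (⊥-elim)
open import Function using (_∘_; id; flip)
open import Relation.Nullary using (Dec; yes; no; ¬?)
open import Relation.Nullary.Decidable using (⌊_⌋; _×-dec_; _⊎-dec_)
open import Relation.Binary.PropositionalEquality
  using (_≡_; _≢_; refl; sym; trans; cong; cong₂; subst; module ≡-Reasoning)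
open import Algebra.Properties.CommutativeMonoid.Sum ℕ.+-0-commutativeMonoid
  using (sum-syntax; sum-cong-≗; ∑-distrib-+; ∑-comm)

module _ {A : Set} where

  ∈-delete : ∀ {x y : A} xs ys → y ∈ xs ++ x ∷ ys → y ≢ x → y ∈ xs ++ ys
  ∈-delete []       ys (here refl) y≢x = ⊥-elim (y≢x refl)
  ∈-delete []       ys (there y∈)  y≢x = y∈
  ∈-delete (_ ∷ xs) ys (here y≡)   y≢x = here y≡
  ∈-delete (_ ∷ xs) ys (there y∈)  y≢x = there (∈-delete xs ys y∈ y≢x)

  length-insert : ∀ (xs : List A) x ys → length (xs ++ x ∷ ys) ≡ suc (length (xs ++ ys))
  length-insert []       x ys = refl
  length-insert (_ ∷ xs) x ys = cong suc (length-insert xs x ys)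

  Unique⇒length≤ : ∀ {xs ys : List A} → Unique xs → All (_∈ ys) xs → length xs ≤ length ys
  Unique⇒length≤ {[]}     _          _             = z≤n
  Unique⇒length≤ {x ∷ xs} (x∉xs ∷ u) (x∈ys ∷ xs⊆ys) with ∈-∃++ x∈ys
  ... | as , bs , refl = subst (suc (length xs) ≤_) (sym (length-insert as x bs))
    (s≤s (Unique⇒length≤ u (All.zipWith (λ (x≢z , z∈) → ∈-delete as bs z∈ (x≢z ∘ sym)) (x∉xs , xs⊆ys))))

  AllPairs-++⁻ˡ : ∀ {R : A → A → Set} xs {ys} → AllPairs R (xs ++ ys) → AllPairs R xs
  AllPairs-++⁻ˡ []       _         = []
  AllPairs-++⁻ˡ (x ∷ xs) (rx ∷ rs) = Allₚ.++⁻ˡ xs rx ∷ AllPairs-++⁻ˡ xs rs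

  AllPairs-++⁻ʳ : ∀ {R : A → A → Set} xs {ys} → AllPairs R (xs ++ ys) → AllPairs R ys
  AllPairs-++⁻ʳ []       rs       = rs
  AllPairs-++⁻ʳ (x ∷ xs) (_ ∷ rs) = AllPairs-++⁻ʳ xs rs

  Linked-++⁻ˡ : ∀ {R : A → A → Set} xs {ys} → Linked R (xs ++ ys) → Linked R xs
  Linked-++⁻ˡ []           _        = []
  Linked-++⁻ˡ (x ∷ [])     _        = [-]
  Linked-++⁻ˡ (x ∷ y ∷ xs) (r ∷ rs) = r ∷ Linked-++⁻ˡ (y ∷ xs) rs

  Linked-++⁻ʳ : ∀ {R : A → A → Set} xs {ys} → Linked R (xs ++ ys) → Linked R ys
  Linked-++⁻ʳ []       rs = rs
  Linked-++⁻ʳ (x ∷ xs) rs = Linked-++⁻ʳ xs (Linked.tail rs)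

  Linked-∷ʳ⁺ : ∀ {R : A → A → Set} xs {w y} → Linked R (xs ++ [ w ]) → R w y → Linked R ((xs ++ [ w ]) ++ [ y ])
  Linked-∷ʳ⁺ []           _        r = r ∷ [-]
  Linked-∷ʳ⁺ (x ∷ [])     (r′ ∷ _) r = r′ ∷ r ∷ [-]
  Linked-∷ʳ⁺ (x ∷ z ∷ xs) (r′ ∷ rs) r = r′ ∷ Linked-∷ʳ⁺ (z ∷ xs) rs r

  AllPairs-map-All : ∀ {P : A → Set} {R S : A → A → Set} {xs} →
    (∀ {x y} → P x → P y → R x y → S x y) → All P xs → AllPairs R xs → AllPairs S xs
  AllPairs-map-All f []         []         = []
  AllPairs-map-All f (px ∷ pxs) (rx ∷ rxs) =
    All.zipWith (λ (py , r) → f px py r) (pxs , rx) ∷ AllPairs-map-All f pxs rxs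

  listsUpTo : ℕ → List A → List (List A)
  listsUpTo zero    xs = [ [] ]
  listsUpTo (suc k) xs = [] ∷ cartesianProductWith _∷_ xs (listsUpTo k xs)

  ∈-listsUpTo : ∀ {xs} k (ys : List A) → length ys ≤ k → All (_∈ xs) ys → ys ∈ listsUpTo k xs
  ∈-listsUpTo zero    []       _         _          = here refl
  ∈-listsUpTo (suc k) []       _         _          = here refl
  ∈-listsUpTo (suc k) (y ∷ ys) (s≤s ≤k) (y∈ ∷ ys∈) =
    there (∈-cartesianProductWith⁺ _∷_ y∈ (∈-listsUpTo k ys ≤k ys∈))

largest-witness : (P : ℕ → Set) → (∀ k → Dec (P k)) → P 0 → (B : ℕ) → (∀ k → P k → k ≤ B) →
  ∃ λ k → P k × (∀ j → P j → j ≤ k)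
largest-witness P P? p0 zero    bound = 0 , p0 , bound
largest-witness P P? p0 (suc B) bound with P? (suc B)
... | yes pB = suc B , pB , bound
... | no ¬pB = largest-witness P P? p0 B λ k pk → below k pk (bound k pk)
  where
  below : ∀ k → P k → k ≤ suc B → k ≤ B
  below k pk k≤ with ℕ.m≤n⇒m<n∨m≡n k≤
  ... | inj₁ (s≤s k≤B) = k≤B
  ... | inj₂ refl      = ⊥-elim (¬pB pk)

↑ˡ≢↑ʳ : ∀ {n m} (i : Fin n) (j : Fin m) → i ↑ˡ m ≢ n ↑ʳ j
↑ˡ≢↑ʳ {n} {m} i j eq
  with () ← trans (sym (Finₚ.splitAt-↑ˡ n i m)) (trans (cong (Fin.splitAt n) eq) (Finₚ.splitAt-↑ʳ n m j))

data SplitAtView {n m} : Fin (n + m) → Set where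
  left  : ∀ i → SplitAtView (i ↑ˡ m)
  right : ∀ j → SplitAtView (n ↑ʳ j)

splitAtView : ∀ {n m} (k : Fin (n + m)) → SplitAtView k
splitAtView {n} k with Fin.splitAt n k in eq
... | inj₁ i = subst SplitAtView (Finₚ.splitAt⁻¹-↑ˡ eq) (left i)
... | inj₂ j = subst SplitAtView (Finₚ.splitAt⁻¹-↑ʳ eq) (right j)

sum-tabulate : ∀ N (f : Fin N → ℕ) → ListAction.sum (tabulate f) ≡ ∑[ i < N ] f i
sum-tabulate zero    f = refl
sum-tabulate (suc N) f = cong (f Fin.zero +_) (sum-tabulate N (f ∘ Fin.suc))

sum-map-allFin : ∀ N (f : Fin N → ℕ) → ListAction.sum (map f (allFin N)) ≡ ∑[ i < N ] f i
sum-map-allFin N f = trans (cong ListAction.sum (Listₚ.map-tabulate id f)) (sum-tabulate N f)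

∑-mono-≤ : ∀ N {f g : Fin N → ℕ} → (∀ i → f i ≤ g i) → ∑[ i < N ] f i ≤ ∑[ i < N ] g i
∑-mono-≤ zero    f≤g = z≤n
∑-mono-≤ (suc N) f≤g = ℕ.+-mono-≤ (f≤g Fin.zero) (∑-mono-≤ N (f≤g ∘ Fin.suc))

∑-const : ∀ N c → ∑[ i < N ] c ≡ N * c
∑-const zero    c = refl
∑-const (suc N) c = cong (c +_) (∑-const N c)

∑∑-const : ∀ a b {f : Fin a → Fin b → ℕ} {c} → (∀ i j → f i j ≡ c) →
  ∑[ i < a ] ∑[ j < b ] f i j ≡ a * (b * c)
∑∑-const a b {c = c} f≡c =
  trans (sum-cong-≗ {a} λ i → trans (sum-cong-≗ {b} (f≡c i)) (∑-const b c)) (∑-const a _)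

∑∑-distrib-+ : ∀ {a b} (f g : Fin a → Fin b → ℕ) →
  ∑[ i < a ] ∑[ j < b ] (f i j + g i j) ≡ ∑[ i < a ] ∑[ j < b ] f i j + ∑[ i < a ] ∑[ j < b ] g i j
∑∑-distrib-+ {a} {b} f g = trans (sum-cong-≗ {a} λ i → ∑-distrib-+ (f i) (g i))
                                 (∑-distrib-+ (λ i → ∑[ j < b ] f i j) (λ i → ∑[ j < b ] g i j))

∑-++ : ∀ n m (f : Fin (n + m) → ℕ) → ∑[ i < n + m ] f i ≡ ∑[ i < n ] f (i ↑ˡ m) + ∑[ j < m ] f (n ↑ʳ j)
∑-++ zero    m f = refl
∑-++ (suc n) m f = trans (cong (f Fin.zero +_) (∑-++ n m (f ∘ Fin.suc))) (sym (ℕ.+-assoc (f Fin.zero) _ _))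

offDiag : ∀ {N} → (Fin N → Fin N → ℕ) → Fin N → Fin N → ℕ
offDiag f u v = if ⌊ u ≟ v ⌋ then 0 else f u v

offDiag-≢ : ∀ {N} (f : Fin N → Fin N → ℕ) {u v} → u ≢ v → offDiag f u v ≡ f u v
offDiag-≢ f {u} {v} u≢v with u ≟ v
... | yes u≡v = ⊥-elim (u≢v u≡v)
... | no _    = refl

offDiag-∘ : ∀ {M N} (f : Fin N → Fin N → ℕ) (ι : Fin M → Fin N) → (∀ {u v} → ι u ≡ ι v → u ≡ v) →
  ∀ u v → offDiag f (ι u) (ι v) ≡ offDiag (λ x y → f (ι x) (ι y)) u v
offDiag-∘ f ι ι-inj u v with u ≟ v
... | no u≢v   = offDiag-≢ f (u≢v ∘ ι-inj)
... | yes refl with ι u ≟ ι u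
...   | yes _    = refl
...   | no ιu≢ιu = ⊥-elim (ιu≢ιu refl)

sumPairs≡∑offDiag : ∀ N f → sumPairs N f ≡ ∑[ u < N ] ∑[ v < N ] offDiag f u v
sumPairs≡∑offDiag N f = trans (cong ListAction.sum (Listₚ.map-cong (λ u → sum-map-allFin N (offDiag f u)) (allFin N)))
                              (sum-map-allFin N (λ u → ∑[ v < N ] offDiag f u v))

sumPairs-mono-≤ : ∀ N {f g : Fin N → Fin N → ℕ} → (∀ u v → u ≢ v → f u v ≤ g u v) →
  sumPairs N f ≤ sumPairs N g
sumPairs-mono-≤ N {f} {g} f≤g rewrite sumPairs≡∑offDiag N f | sumPairs≡∑offDiag N g =
  ∑-mono-≤ N λ u → ∑-mono-≤ N λ v → entry u v
  where
  entry : ∀ u v → offDiag f u v ≤ offDiag g u v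
  entry u v with u ≟ v
  ... | yes _  = z≤n
  ... | no u≢v = f≤g u v u≢v

sumPairs-cong : ∀ N {f g : Fin N → Fin N → ℕ} → (∀ u v → u ≢ v → f u v ≡ g u v) → sumPairs N f ≡ sumPairs N g
sumPairs-cong N {f} {g} f≡g rewrite sumPairs≡∑offDiag N f | sumPairs≡∑offDiag N g =
  sum-cong-≗ λ u → sum-cong-≗ λ v → entry u v
  where
  entry : ∀ u v → offDiag f u v ≡ offDiag g u v
  entry u v with u ≟ v
  ... | yes _  = refl
  ... | no u≢v = f≡g u v u≢v

sumPairs-+ : ∀ N (f g : Fin N → Fin N → ℕ) → sumPairs N (λ u v → f u v + g u v) ≡ sumPairs N f + sumPairs N g
sumPairs-+ N f g
  rewrite sumPairs≡∑offDiag N (λ u v → f u v + g u v) | sumPairs≡∑offDiag N f | sumPairs≡∑offDiag N g =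
  trans (sum-cong-≗ λ u → sum-cong-≗ (entry u)) (∑∑-distrib-+ (offDiag f) (offDiag g))
  where
  entry : ∀ u v → offDiag (λ u v → f u v + g u v) u v ≡ offDiag f u v + offDiag g u v
  entry u v with u ≟ v
  ... | yes _ = refl
  ... | no _  = refl

sumPairs-transpose : ∀ N (f : Fin N → Fin N → ℕ) → sumPairs N f ≡ sumPairs N (flip f)
sumPairs-transpose N f rewrite sumPairs≡∑offDiag N f | sumPairs≡∑offDiag N (flip f) =
  trans (sum-cong-≗ λ u → sum-cong-≗ λ v → entry u v) (∑-comm (λ u v → offDiag (flip f) v u))
  where
  entry : ∀ u v → offDiag f u v ≡ offDiag (flip f) v u
  entry u v with u ≟ v | v ≟ u
  ... | yes _    | yes _    = refl
  ... | no _     | no _     = refl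
  ... | yes refl | no u≢u   = ⊥-elim (u≢u refl)
  ... | no u≢u   | yes refl = ⊥-elim (u≢u refl)

∑-offDiag-const : ∀ N (u : Fin N) c → ∑[ v < N ] offDiag (λ _ _ → c) u v ≡ (N ∸ 1) * c
∑-offDiag-const (suc N)       Fin.zero    c = ∑-const N c
∑-offDiag-const (suc (suc N)) (Fin.suc u) c =
  cong (c +_) (trans (sum-cong-≗ (offDiag-∘ (λ _ _ → c) Fin.suc Finₚ.suc-injective u)) (∑-offDiag-const (suc N) u c))

sumPairs-const : ∀ N c → sumPairs N (λ _ _ → c) ≡ N * ((N ∸ 1) * c)
sumPairs-const N c = trans (sumPairs≡∑offDiag N _) (trans (sum-cong-≗ λ u → ∑-offDiag-const N u c) (∑-const N _))

sumPairs-++ : ∀ n m (f : Fin (n + m) → Fin (n + m) → ℕ) →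
  sumPairs (n + m) f ≡ sumPairs n (λ u v → f (u ↑ˡ m) (v ↑ˡ m))
    + (∑[ u < n ] ∑[ e < m ] f (u ↑ˡ m) (n ↑ʳ e) + ∑[ e < m ] ∑[ u < n ] f (n ↑ʳ e) (u ↑ˡ m))
    + sumPairs m (λ e e′ → f (n ↑ʳ e) (n ↑ʳ e′))
sumPairs-++ n m f = begin
    sumPairs (n + m) f
  ≡⟨ trans (sumPairs≡∑offDiag (n + m) f) (∑-++ n m _) ⟩
    ∑[ u < n ] row (u ↑ˡ m) + ∑[ e < m ] row (n ↑ʳ e)
  ≡⟨ cong₂ _+_ (split-rows (_↑ˡ m)) (split-rows (n ↑ʳ_)) ⟩
    (∑[ u < n ] ∑[ v < n ] offDiag f (u ↑ˡ m) (v ↑ˡ m) + ∑[ u < n ] ∑[ e < m ] offDiag f (u ↑ˡ m) (n ↑ʳ e))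
      + (∑[ e < m ] ∑[ u < n ] offDiag f (n ↑ʳ e) (u ↑ˡ m)
         + ∑[ e < m ] ∑[ e′ < m ] offDiag f (n ↑ʳ e) (n ↑ʳ e′))
  ≡⟨ cong₂ _+_ (cong₂ _+_ block-vv block-vm) (cong₂ _+_ block-mv block-mm) ⟩
    (Svv + Svm) + (Smv + Smm)
  ≡⟨ regroup Svv Svm Smv Smm ⟩
    Svv + (Svm + Smv) + Smm
  ∎
  where
  open ≡-Reasoning
  Svv Svm Smv Smm : ℕ
  Svv = sumPairs n (λ u v → f (u ↑ˡ m) (v ↑ˡ m))
  Svm = ∑[ u < n ] ∑[ e < m ] f (u ↑ˡ m) (n ↑ʳ e)
  Smv = ∑[ e < m ] ∑[ u < n ] f (n ↑ʳ e) (u ↑ˡ m)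
  Smm = sumPairs m (λ e e′ → f (n ↑ʳ e) (n ↑ʳ e′))
  row : Fin (n + m) → ℕ
  row x = ∑[ y < n + m ] offDiag f x y
  split-rows : ∀ {k} (x : Fin k → Fin (n + m)) → ∑[ i < k ] row (x i)
    ≡ ∑[ i < k ] ∑[ v < n ] offDiag f (x i) (v ↑ˡ m) + ∑[ i < k ] ∑[ e < m ] offDiag f (x i) (n ↑ʳ e)
  split-rows x = trans (sum-cong-≗ λ i → ∑-++ n m (offDiag f (x i)))
    (∑-distrib-+ (λ i → ∑[ v < n ] offDiag f (x i) (v ↑ˡ m)) (λ i → ∑[ e < m ] offDiag f (x i) (n ↑ʳ e)))
  block-vv : ∑[ u < n ] ∑[ v < n ] offDiag f (u ↑ˡ m) (v ↑ˡ m) ≡ Svv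
  block-vv = trans (sum-cong-≗ λ u → sum-cong-≗ λ v → offDiag-∘ f (_↑ˡ m) (Finₚ.↑ˡ-injective m _ _) u v)
                   (sym (sumPairs≡∑offDiag n _))
  block-vm : ∑[ u < n ] ∑[ e < m ] offDiag f (u ↑ˡ m) (n ↑ʳ e) ≡ Svm
  block-vm = sum-cong-≗ λ u → sum-cong-≗ λ e → offDiag-≢ f (↑ˡ≢↑ʳ {n} {m} u e)
  block-mv : ∑[ e < m ] ∑[ u < n ] offDiag f (n ↑ʳ e) (u ↑ˡ m) ≡ Smv
  block-mv = sum-cong-≗ λ e → sum-cong-≗ λ u → offDiag-≢ f (↑ˡ≢↑ʳ {n} {m} u e ∘ sym)
  block-mm : ∑[ e < m ] ∑[ e′ < m ] offDiag f (n ↑ʳ e) (n ↑ʳ e′) ≡ Smm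
  block-mm = trans (sum-cong-≗ λ e → sum-cong-≗ λ e′ → offDiag-∘ f (n ↑ʳ_) (Finₚ.↑ʳ-injective n _ _) e e′)
                   (sym (sumPairs≡∑offDiag m _))
  regroup : ∀ a b c d → (a + b) + (c + d) ≡ a + (b + c) + d
  regroup = solve-∀

[1+k]C2≡k+kC2 : ∀ k → suc k C 2 ≡ k + k C 2
[1+k]C2≡k+kC2 k = trans (sym (nCk+nC[k+1]≡[n+1]C[k+1] k 1)) (cong (_+ k C 2) (nC1≡n k))

2*kC2≡k*[k∸1] : ∀ k → 2 * (k C 2) ≡ k * (k ∸ 1)
2*kC2≡k*[k∸1] zero          = refl
2*kC2≡k*[k∸1] (suc zero)    = refl
2*kC2≡k*[k∸1] (suc (suc k)) = begin
  2 * (suc (suc k) C 2)           ≡⟨ cong (2 *_) ([1+k]C2≡k+kC2 (suc k)) ⟩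
  2 * (suc k + suc k C 2)         ≡⟨ ℕ.*-distribˡ-+ 2 (suc k) (suc k C 2) ⟩
  2 * suc k + 2 * (suc k C 2)     ≡⟨ cong (2 * suc k +_) (2*kC2≡k*[k∸1] (suc k)) ⟩
  2 * suc k + suc k * k           ≡⟨ rearrange k ⟩
  suc (suc k) * suc k             ∎
  where
  open ≡-Reasoning
  rearrange : ∀ k → 2 * suc k + suc k * k ≡ suc (suc k) * suc k
  rearrange = solve-∀

[n+m]C2≡nC2+[n*m+mC2] : ∀ n m → (n + m) C 2 ≡ n C 2 + (n * m + m C 2)
[n+m]C2≡nC2+[n*m+mC2] n zero    = begin
  (n + 0) C 2                ≡⟨ cong (_C 2) (ℕ.+-identityʳ n) ⟩
  n C 2                      ≡⟨ rearrange n (n C 2) ⟨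
  n C 2 + (n * 0 + 0 C 2)    ∎
  where
  open ≡-Reasoning
  rearrange : ∀ n c → c + (n * 0 + 0) ≡ c
  rearrange = solve-∀
[n+m]C2≡nC2+[n*m+mC2] n (suc m) = begin
  (n + suc m) C 2                        ≡⟨ cong (_C 2) (ℕ.+-suc n m) ⟩
  suc (n + m) C 2                        ≡⟨ [1+k]C2≡k+kC2 (n + m) ⟩
  n + m + (n + m) C 2                    ≡⟨ cong (n + m +_) ([n+m]C2≡nC2+[n*m+mC2] n m) ⟩
  n + m + (n C 2 + (n * m + m C 2))      ≡⟨ rearrange n m (n C 2) (m C 2) ⟩
  n C 2 + (n * suc m + (m + m C 2))      ≡⟨ cong (λ x → n C 2 + (n * suc m + x)) ([1+k]C2≡k+kC2 m) ⟨
  n C 2 + (n * suc m + suc m C 2)        ∎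
  where
  open ≡-Reasoning
  rearrange : ∀ n m a b → n + m + (a + (n * m + b)) ≡ a + (n * suc m + (m + b))
  rearrange = solve-∀

-- The ordered pairs of distinct vertices of S(G) that are not both original:
-- n·m pairs in each direction between V(G) and E(G), and m(m − 1) pairs inside E(G).
newPairs : ℕ → ℕ → ℕ
newPairs n m = n * (m * 2) + m * (m ∸ 1)

2*[[n+m]C2∸nC2]≡newPairs : ∀ n m → 2 * ((n + m) C 2 ∸ n C 2) ≡ newPairs n m
2*[[n+m]C2∸nC2]≡newPairs n m = begin
  2 * ((n + m) C 2 ∸ n C 2)                ≡⟨ cong (λ x → 2 * (x ∸ n C 2)) ([n+m]C2≡nC2+[n*m+mC2] n m) ⟩
  2 * (n C 2 + (n * m + m C 2) ∸ n C 2)    ≡⟨ cong (2 *_) (ℕ.m+n∸m≡n (n C 2) _) ⟩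
  2 * (n * m + m C 2)                      ≡⟨ ℕ.*-distribˡ-+ 2 (n * m) (m C 2) ⟩
  2 * (n * m) + 2 * (m C 2)                ≡⟨ cong₂ _+_ (swap n m) (2*kC2≡k*[k∸1] m) ⟩
  n * (m * 2) + m * (m ∸ 1)                ∎
  where
  open ≡-Reasoning
  swap : ∀ n m → 2 * (n * m) ≡ n * (m * 2)
  swap = solve-∀

-- Paths in digraphs

module _ {A : Set} where

  secondVertex : List A → A → A
  secondVertex []      v = v
  secondVertex (w ∷ _) v = w

  penultimateVertex : A → List A → A
  penultimateVertex u []      = u
  penultimateVertex u (w ∷ p) = penultimateVertex w p

  penultimateVertex-∈ : ∀ (w : A) p → penultimateVertex w p ∈ w ∷ p
  penultimateVertex-∈ w []      = here refl
  penultimateVertex-∈ w (x ∷ p) = there (penultimateVertex-∈ x p)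

  All≢-∷ʳ⇒≢ : ∀ {x y : A} xs → All (x ≢_) (xs ++ [ y ]) → x ≢ y
  All≢-∷ʳ⇒≢ []       (x≢y ∷ _) = x≢y
  All≢-∷ʳ⇒≢ (_ ∷ xs) (_ ∷ x≢)  = All≢-∷ʳ⇒≢ xs x≢

  All≢⇒∉ : ∀ {x : A} {xs} → All (x ≢_) xs → x ∉ xs
  All≢⇒∉ x≢ x∈ = All.lookup x≢ x∈ refl

module _ (D : Digraph) where

  Linked-second : ∀ {u v} p → Linked (Arc D) (u ∷ p ++ [ v ]) → Arc D u (secondVertex p v)
  Linked-second []      l = Linked.head l
  Linked-second (_ ∷ p) l = Linked.head l

  Linked-penultimate : ∀ {u v} p → Linked (Arc D) (u ∷ p ++ [ v ]) → Arc D (penultimateVertex u p) v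
  Linked-penultimate []      l        = Linked.head l
  Linked-penultimate (_ ∷ p) (_ ∷ l) = Linked-penultimate p l

  secondVertex-injective : ∀ {u v} p q → IsPath D u v p → IsPath D u v q →
    p ≢ q × Disjoint p q → secondVertex p v ≢ secondVertex q v
  secondVertex-injective []      []      _               _               (p≢q , _) _   = p≢q refl
  secondVertex-injective []      (w ∷ q) _               (_ ∷ (w≢ ∷ _) , _) _      w≡v = All≢-∷ʳ⇒≢ q w≢ (sym w≡v)
  secondVertex-injective (w ∷ p) []      (_ ∷ (w≢ ∷ _) , _) _               _      w≡v = All≢-∷ʳ⇒≢ p w≢ w≡v
  secondVertex-injective (w ∷ p) (_ ∷ q) _               _               (_ , p∩q) w≡ =
    p∩q (here refl , here w≡)

  penultimateVertex-injective : ∀ {u v} p q → IsPath D u v p → IsPath D u v q →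
    p ≢ q × Disjoint p q → penultimateVertex u p ≢ penultimateVertex u q
  penultimateVertex-injective []      []      _               _               (p≢q , _) _ = p≢q refl
  penultimateVertex-injective []      (w ∷ q) _               ((u≢ ∷ _) , _) _         u≡ =
    All≢⇒∉ u≢ (∈-++⁺ˡ (subst (_∈ w ∷ q) (sym u≡) (penultimateVertex-∈ w q)))
  penultimateVertex-injective (w ∷ p) []      ((u≢ ∷ _) , _) _               _         ≡u =
    All≢⇒∉ u≢ (∈-++⁺ˡ (subst (_∈ w ∷ p) ≡u (penultimateVertex-∈ w p)))
  penultimateVertex-injective (w ∷ p) (x ∷ q) _               _               (_ , p∩q) eq =
    p∩q (penultimateVertex-∈ w p , subst (_∈ x ∷ q) (sym eq) (penultimateVertex-∈ x q))

  IDFamily-length≤out : ∀ {u v ps} (outs : List (Fin (N D))) → (∀ w → Arc D u w → w ∈ outs) →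
    IDFamily D u v ps → length ps ≤ length outs
  IDFamily-length≤out {u} {v} {ps} outs out⊆ (paths , pairs) =
    subst (_≤ length outs) (Listₚ.length-map (λ p → secondVertex p v) ps)
      (Unique⇒length≤ (AllPairsₚ.map⁺ (AllPairs-map-All (λ {p} {q} → secondVertex-injective p q) paths pairs))
                      (Allₚ.map⁺ (All.map (λ {p} (_ , l) → out⊆ _ (Linked-second p l)) paths)))

  IDFamily-length≤in : ∀ {u v ps} (ins : List (Fin (N D))) → (∀ w → Arc D w v → w ∈ ins) →
    IDFamily D u v ps → length ps ≤ length ins
  IDFamily-length≤in {u} {v} {ps} ins in⊆ (paths , pairs) =
    subst (_≤ length ins) (Listₚ.length-map (penultimateVertex u) ps)
      (Unique⇒length≤ (AllPairsₚ.map⁺ (AllPairs-map-All (λ {p} {q} → penultimateVertex-injective p q) paths pairs))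
                      (Allₚ.map⁺ (All.map (λ {p} (_ , l) → in⊆ _ (Linked-penultimate p l)) paths)))

module _ (D : Digraph) (arc? : ∀ u v → Dec (Arc D u v)) where

  private
    V : Set
    V = Fin (N D)

  open import Data.List.Membership.DecPropositional (Fin._≟_ {N D}) using (_∈?_)
  open import Data.List.Relation.Unary.Unique.DecPropositional (Fin._≟_ {N D}) using (unique?)

  disjoint? : (p q : List V) → Dec (Disjoint p q)
  disjoint? p q with All.all? (λ x → ¬? (x ∈? q)) p
  ... | yes p∉q = yes λ (x∈p , x∈q) → All.lookup p∉q x∈p x∈q
  ... | no ¬p∉q = no λ p∩q → ¬p∉q (All.tabulate λ x∈p x∈q → p∩q (x∈p , x∈q))

  isPath? : ∀ u v p → Dec (IsPath D u v p)
  isPath? u v p = unique? _ ×-dec Linked.linked? arc? _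

  idFamily? : ∀ u v ps → Dec (IDFamily D u v ps)
  idFamily? u v ps = All.all? (isPath? u v) ps
    ×-dec AllPairs.allPairs? (λ p q → ¬? (Listₚ.≡-dec Fin._≟_ p q) ×-dec disjoint? p q) ps

  candidatePaths : List (List V)
  candidatePaths = listsUpTo (N D) (allFin (N D))

  IsPath⇒∈candidatePaths : ∀ {u v} p → IsPath D u v p → p ∈ candidatePaths
  IsPath⇒∈candidatePaths p (_ ∷ unique , _) =
    ∈-listsUpTo (N D) p
      (subst (length p ≤_) (Listₚ.length-tabulate id)
        (Unique⇒length≤ (AllPairs-++⁻ˡ p unique) (All.tabulate λ {x} _ → ∈-allFin x)))
      (All.tabulate λ {x} _ → ∈-allFin x)

  IDFamily⇒length≤ : ∀ {u v} ps → IDFamily D u v ps → length ps ≤ length candidatePaths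
  IDFamily⇒length≤ ps (paths , pairs) =
    Unique⇒length≤ (AllPairs.map proj₁ pairs) (All.map (λ {p} → IsPath⇒∈candidatePaths p) paths)

  candidateFamilies : List (List (List V))
  candidateFamilies = listsUpTo (length candidatePaths) candidatePaths

  HasIDFamilyOfSize : V → V → ℕ → Set
  HasIDFamilyOfSize u v k = ∃ λ ps → IDFamily D u v ps × length ps ≡ k

  hasIDFamilyOfSize? : ∀ u v k → Dec (HasIDFamilyOfSize u v k)
  hasIDFamilyOfSize? u v k with Any.any? (λ ps → idFamily? u v ps ×-dec (length ps ℕ.≟ k)) candidateFamilies
  ... | yes found = let ps , _ , family = find found in yes (ps , family)
  ... | no none   = no λ { (ps , family , refl) → none (lose
        (∈-listsUpTo _ ps (IDFamily⇒length≤ ps family) (All.map (λ {p} → IsPath⇒∈candidatePaths p) (proj₁ family)))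
        (family , refl)) }

  kappa-exists : ∀ u v → ∃ (IsKappa D u v)
  kappa-exists u v
    with k , (ps , family , refl) , maximal ← largest-witness (HasIDFamilyOfSize u v) (hasIDFamilyOfSize? u v)
           ([] , ([] , []) , refl) (length candidatePaths) (λ { _ (ps , family , refl) → IDFamily⇒length≤ ps family })
    = length ps , (ps , family , refl) , λ qs family′ → maximal (length qs) (qs , family′ , refl)

  total-exists : ∃ (IsTotal D)
  total-exists = _ , (λ u v → proj₁ (kappa-exists u v)) , (λ u v _ → proj₂ (kappa-exists u v)) , refl

module _ (D : Digraph) (irreflexive : ∀ {x y} → Arc D x y → x ≢ y) where

  open import Data.List.Membership.DecPropositional (Fin._≟_ {N D}) using (_∈?_)

  IsPath-arc : ∀ {u v} → Arc D u v → IsPath D u v []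
  IsPath-arc uv = ((irreflexive uv ∷ []) ∷ [] ∷ []) , (uv ∷ [-])

  IsPath-prefix : ∀ {u v p w} → IsPath D u v p → w ∈ p → ∃ (IsPath D u w)
  IsPath-prefix {u} {v} (unique , linked) w∈p with as , bs , refl ← ∈-∃++ w∈p =
    as , AllPairs-++⁻ˡ (u ∷ as ++ [ _ ]) (subst Unique split unique)
       , Linked-++⁻ˡ (u ∷ as ++ [ _ ]) (subst (Linked (Arc D)) split linked)
    where
    split : u ∷ (as ++ _ ∷ bs) ++ [ v ] ≡ (u ∷ as ++ [ _ ]) ++ (bs ++ [ v ])
    split = cong (u ∷_) (trans (Listₚ.++-assoc as _ [ v ]) (sym (Listₚ.++-assoc as [ _ ] (bs ++ [ v ]))))

  IsPath-suffix : ∀ {u v p w} → IsPath D u v p → w ∈ p → ∃ λ q → IsPath D w v q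
  IsPath-suffix {u} {v} (unique , linked) w∈p with as , bs , refl ← ∈-∃++ w∈p =
    bs , AllPairs-++⁻ʳ (u ∷ as) (subst Unique split unique)
       , Linked-++⁻ʳ (u ∷ as) (subst (Linked (Arc D)) split linked)
    where
    split : u ∷ (as ++ _ ∷ bs) ++ [ v ] ≡ (u ∷ as) ++ (_ ∷ bs ++ [ v ])
    split = cong (u ∷_) (Listₚ.++-assoc as _ [ v ])

  IsPath-extendʳ : ∀ {u w p v} → IsPath D u w p → Arc D w v → u ≢ v → ∃ (IsPath D u v)
  IsPath-extendʳ {u} {w} {p} {v} path wv u≢v with v ∈? p
  ... | yes v∈p = IsPath-prefix path v∈p
  ... | no  v∉p = p ++ [ w ] ,
      Uniqueₚ.++⁺ (proj₁ path) ([] ∷ []) (λ { (v∈ , here refl) → v∉upw v∈ }) ,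
      Linked-∷ʳ⁺ (u ∷ p) (proj₂ path) wv
    where
    v∉upw : v ∉ u ∷ p ++ [ w ]
    v∉upw (here v≡u) = u≢v (sym v≡u)
    v∉upw (there v∈) with ∈-++⁻ p v∈
    ... | inj₁ v∈p      = v∉p v∈p
    ... | inj₂ (here v≡w) = irreflexive wv (sym v≡w)

  IsPath-extendˡ : ∀ {u w p v} → Arc D u w → IsPath D w v p → u ≢ v → ∃ (IsPath D u v)
  IsPath-extendˡ {u} {w} {p} {v} uw path u≢v with u ∈? p
  ... | yes u∈p = IsPath-suffix path u∈p
  ... | no  u∉p = w ∷ p ,
      (All.tabulate (λ u∈ u≡ → u∉wpv (subst (_∈ _) (sym u≡) u∈)) ∷ proj₁ path) ,
      (uw ∷ proj₂ path)
    where
    u∉wpv : u ∉ w ∷ p ++ [ v ]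
    u∉wpv (here u≡w) = irreflexive uw u≡w
    u∉wpv (there u∈) with ∈-++⁻ p u∈
    ... | inj₁ u∈p       = u∉p u∈p
    ... | inj₂ (here u≡v) = u≢v u≡v

-- The subdivision

SameEdge-unique : ∀ {G} → Simple G → ∀ {e f uv} → SameEdge (ends G e) uv → SameEdge (ends G f) uv → e ≡ f
SameEdge-unique (_ , no-parallel) {e} {f} (inj₁ (a , b)) (inj₁ (c , d)) =
  no-parallel e f (inj₁ (trans a (sym c) , trans b (sym d)))
SameEdge-unique (_ , no-parallel) {e} {f} (inj₁ (a , b)) (inj₂ (c , d)) =
  no-parallel e f (inj₂ (trans a (sym d) , trans b (sym c)))
SameEdge-unique (_ , no-parallel) {e} {f} (inj₂ (a , b)) (inj₁ (c , d)) =
  no-parallel e f (inj₂ (trans a (sym d) , trans b (sym c)))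
SameEdge-unique (_ , no-parallel) {e} {f} (inj₂ (a , b)) (inj₂ (c , d)) =
  no-parallel e f (inj₁ (trans a (sym c) , trans b (sym d)))

module Subdivision (G : Graph) where

  Vertex : Set
  Vertex = Fin (n G + m G)

  vert : Fin (n G) → Vertex
  vert u = u ↑ˡ m G

  mid : Fin (m G) → Vertex
  mid e = n G ↑ʳ e

  vert-injective : ∀ {u v} → vert u ≡ vert v → u ≡ v
  vert-injective = Finₚ.↑ˡ-injective (m G) _ _

  mid-injective : ∀ {e f} → mid e ≡ mid f → e ≡ f
  mid-injective = Finₚ.↑ʳ-injective (n G) _ _

  vert≢mid : ∀ {u e} → vert u ≢ mid e
  vert≢mid = ↑ˡ≢↑ʳ _ _

  vertexView : ∀ x → SplitAtView {n G} {m G} x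
  vertexView = splitAtView

  originals : List Vertex → List (Fin (n G))
  originals []       = []
  originals (x ∷ xs) = [ (λ u → u ∷ originals xs) , (λ _ → originals xs) ]′ (Fin.splitAt (n G) x)

  originals-vert : ∀ u xs → originals (vert u ∷ xs) ≡ u ∷ originals xs
  originals-vert u xs rewrite Finₚ.splitAt-↑ˡ (n G) u (m G) = refl

  originals-mid : ∀ e xs → originals (mid e ∷ xs) ≡ originals xs
  originals-mid e xs rewrite Finₚ.splitAt-↑ʳ (n G) (m G) e = refl

  originals-++ : ∀ xs ys → originals (xs ++ ys) ≡ originals xs ++ originals ys
  originals-++ []       ys = refl
  originals-++ (x ∷ xs) ys with vertexView x
  ... | left u = trans (originals-vert u (xs ++ ys))
                   (trans (cong (u ∷_) (originals-++ xs ys)) (cong (_++ originals ys) (sym (originals-vert u xs))))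
  ... | right e = trans (originals-mid e (xs ++ ys))
                   (trans (originals-++ xs ys) (cong (_++ originals ys) (sym (originals-mid e xs))))

  ∈-originals⁻ : ∀ {u} xs → u ∈ originals xs → vert u ∈ xs
  ∈-originals⁻ (x ∷ xs) u∈ with vertexView x
  ... | right e = there (∈-originals⁻ xs (subst (_ ∈_) (originals-mid e xs) u∈))
  ... | left v with subst (_ ∈_) (originals-vert v xs) u∈
  ...   | here refl = here refl
  ...   | there u∈′ = there (∈-originals⁻ xs u∈′)

  ∈-originals⁺ : ∀ {u} xs → vert u ∈ xs → u ∈ originals xs
  ∈-originals⁺ (x ∷ xs) (here refl) = subst (_ ∈_) (sym (originals-vert _ xs)) (here refl)
  ∈-originals⁺ (x ∷ xs) (there u∈) with vertexView x
  ... | left v = subst (_ ∈_) (sym (originals-vert v xs)) (there (∈-originals⁺ xs u∈))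
  ... | right e = subst (_ ∈_) (sym (originals-mid e xs)) (∈-originals⁺ xs u∈)

  originals-Unique : ∀ {xs} → Unique xs → Unique (originals xs)
  originals-Unique []                 = []
  originals-Unique {x ∷ xs} (x∉ ∷ u) with vertexView x
  ... | left v = subst Unique (sym (originals-vert v xs))
                   (All.tabulate (λ w∈ v≡w → All≢⇒∉ x∉ (subst (_∈ xs) (cong vert (sym v≡w)) (∈-originals⁻ xs w∈)))
                    ∷ originals-Unique u)
  ... | right e = subst Unique (sym (originals-mid e xs)) (originals-Unique u)

  originals-Disjoint : ∀ {p q} → Disjoint p q → Disjoint (originals p) (originals q)
  originals-Disjoint {p} {q} p∩q (u∈p , u∈q) = p∩q (∈-originals⁻ p u∈p , ∈-originals⁻ q u∈q)

  end₁ end₂ : Fin (m G) → Fin (n G)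
  end₁ e = proj₁ (ends G e)
  end₂ e = proj₂ (ends G e)

  ends-S-first : ∀ e → ends (S G) (e ↑ˡ m G) ≡ (vert (end₁ e) , mid e)
  ends-S-first e rewrite Finₚ.splitAt-↑ˡ (m G) e (m G) = refl

  ends-S-second : ∀ e → ends (S G) (m G ↑ʳ e) ≡ (vert (end₂ e) , mid e)
  ends-S-second e rewrite Finₚ.splitAt-↑ʳ (m G) (m G) e = refl

  module Oriented (dS : Orientation (S G)) where

    DS : Digraph
    DS = orient (S G) dS

    first second : Fin (m G) → Bool
    first e  = dS (e ↑ˡ m G)
    second e = dS (m G ↑ʳ e)

    -- Endpoints of SArc are vert/mid applications, not constructor patterns, so the lemmas
    -- below that match an arc against such endpoints take them as explicit equations.
    data SArc : Vertex → Vertex → Set where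
      enter₁ : ∀ e → first e  ≡ true  → SArc (vert (end₁ e)) (mid e)
      enter₂ : ∀ e → second e ≡ true  → SArc (vert (end₂ e)) (mid e)
      leave₁ : ∀ e → first e  ≡ false → SArc (mid e) (vert (end₁ e))
      leave₂ : ∀ e → second e ≡ false → SArc (mid e) (vert (end₂ e))

    toSArc : ∀ {x y} → Arc DS x y → SArc x y
    toSArc (i , inj₁ (i≡xy , forward)) with splitAtView {m G} {m G} i
    ... | left e  with refl , refl ← ,-injective (trans (sym (ends-S-first e)) i≡xy)  = enter₁ e forward
    ... | right e with refl , refl ← ,-injective (trans (sym (ends-S-second e)) i≡xy) = enter₂ e forward
    toSArc (i , inj₂ (i≡yx , backward)) with splitAtView {m G} {m G} i
    ... | left e  with refl , refl ← ,-injective (trans (sym (ends-S-first e)) i≡yx)  = leave₁ e backward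
    ... | right e with refl , refl ← ,-injective (trans (sym (ends-S-second e)) i≡yx) = leave₂ e backward

    fromSArc : ∀ {x y} → SArc x y → Arc DS x y
    fromSArc (enter₁ e forward)  = e ↑ˡ m G , inj₁ (ends-S-first e , forward)
    fromSArc (enter₂ e forward)  = m G ↑ʳ e , inj₁ (ends-S-second e , forward)
    fromSArc (leave₁ e backward) = e ↑ˡ m G , inj₂ (ends-S-first e , backward)
    fromSArc (leave₂ e backward) = m G ↑ʳ e , inj₂ (ends-S-second e , backward)

    SArc-vert-vert : ∀ {x y a b} → SArc x y → x ≡ vert a → y ≢ vert b
    SArc-vert-vert (enter₁ _ _) _    y≡ = vert≢mid (sym y≡)
    SArc-vert-vert (enter₂ _ _) _    y≡ = vert≢mid (sym y≡)
    SArc-vert-vert (leave₁ _ _) x≡ _    = vert≢mid (sym x≡)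
    SArc-vert-vert (leave₂ _ _) x≡ _    = vert≢mid (sym x≡)

    SArc-mid-mid : ∀ {x y e f} → SArc x y → x ≡ mid e → y ≢ mid f
    SArc-mid-mid (enter₁ _ _) x≡ _  = vert≢mid x≡
    SArc-mid-mid (enter₂ _ _) x≡ _  = vert≢mid x≡
    SArc-mid-mid (leave₁ _ _) _  y≡ = vert≢mid y≡
    SArc-mid-mid (leave₂ _ _) _  y≡ = vert≢mid y≡

    irreflexive : ∀ {x y} → Arc DS x y → x ≢ y
    irreflexive xy with toSArc xy
    ... | enter₁ _ _ = vert≢mid
    ... | enter₂ _ _ = vert≢mid
    ... | leave₁ _ _ = vert≢mid ∘ sym
    ... | leave₂ _ _ = vert≢mid ∘ sym

    outNeighbours inNeighbours : Fin (m G) → List Vertex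
    outNeighbours e = (if first e then [] else [ vert (end₁ e) ]) ++ (if second e then [] else [ vert (end₂ e) ])
    inNeighbours e  = (if first e then [ vert (end₁ e) ] else []) ++ (if second e then [ vert (end₂ e) ] else [])

    degree-mid : ∀ e → length (outNeighbours e) + length (inNeighbours e) ≡ 2
    degree-mid e with first e | second e
    ... | true  | true  = refl
    ... | true  | false = refl
    ... | false | true  = refl
    ... | false | false = refl

    ∈-outNeighbours : ∀ {x w e} → SArc x w → x ≡ mid e → w ∈ outNeighbours e
    ∈-outNeighbours (enter₁ _ _) x≡ = ⊥-elim (vert≢mid x≡)
    ∈-outNeighbours (enter₂ _ _) x≡ = ⊥-elim (vert≢mid x≡)
    ∈-outNeighbours (leave₁ e backward) x≡ with refl ← mid-injective x≡ rewrite backward = here refl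
    ∈-outNeighbours (leave₂ e backward) x≡ with refl ← mid-injective x≡ rewrite backward =
      ∈-++⁺ʳ (if first e then [] else [ vert (end₁ e) ]) (here refl)

    ∈-inNeighbours : ∀ {x w e} → SArc w x → x ≡ mid e → w ∈ inNeighbours e
    ∈-inNeighbours (leave₁ _ _) x≡ = ⊥-elim (vert≢mid x≡)
    ∈-inNeighbours (leave₂ _ _) x≡ = ⊥-elim (vert≢mid x≡)
    ∈-inNeighbours (enter₁ e forward) x≡ with refl ← mid-injective x≡ rewrite forward = here refl
    ∈-inNeighbours (enter₂ e forward) x≡ with refl ← mid-injective x≡ rewrite forward =
      ∈-++⁺ʳ (if first e then [ vert (end₁ e) ] else []) (here refl)

    IDFamily-from-mid : ∀ e {y ps} → IDFamily DS (mid e) y ps → length ps ≤ length (outNeighbours e)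
    IDFamily-from-mid e = IDFamily-length≤out DS (outNeighbours e) (λ w xw → ∈-outNeighbours (toSArc xw) refl)

    IDFamily-to-mid : ∀ e {y ps} → IDFamily DS y (mid e) ps → length ps ≤ length (inNeighbours e)
    IDFamily-to-mid e = IDFamily-length≤in DS (inNeighbours e) (λ w wx → ∈-inNeighbours (toSArc wx) refl)

    κ-mid-out+in≤2 : ∀ e {y k₁ k₂} → IsKappa DS (mid e) y k₁ → IsKappa DS y (mid e) k₂ → k₁ + k₂ ≤ 2
    κ-mid-out+in≤2 e ((ps , family , refl) , _) ((qs , family′ , refl) , _) =
      subst (length ps + length qs ≤_) (degree-mid e)
        (ℕ.+-mono-≤ (IDFamily-from-mid e family) (IDFamily-to-mid e family′))

    module Projection (d : Orientation G) (first≡d : ∀ e → first e ≡ d e) where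

      DG : Digraph
      DG = orient G d

      through-mid : ∀ {x y y′ z a w} → SArc x y → SArc y′ z → y ≡ y′ → x ≡ vert a → z ≡ vert w →
        ∃ λ e → y ≡ mid e × SameEdge (ends G e) (a , w) × Arc DG a w
      through-mid (leave₁ _ _) _ _ x≡ _ = ⊥-elim (vert≢mid (sym x≡))
      through-mid (leave₂ _ _) _ _ x≡ _ = ⊥-elim (vert≢mid (sym x≡))
      through-mid (enter₁ _ _) (enter₁ _ _) y≡ _ _ = ⊥-elim (vert≢mid (sym y≡))
      through-mid (enter₁ _ _) (enter₂ _ _) y≡ _ _ = ⊥-elim (vert≢mid (sym y≡))
      through-mid (enter₂ _ _) (enter₁ _ _) y≡ _ _ = ⊥-elim (vert≢mid (sym y≡))
      through-mid (enter₂ _ _) (enter₂ _ _) y≡ _ _ = ⊥-elim (vert≢mid (sym y≡))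
      through-mid (enter₁ e forward) (leave₁ _ backward) y≡ _ _ with refl ← mid-injective y≡
        with () ← trans (sym forward) backward
      through-mid (enter₂ e forward) (leave₂ _ backward) y≡ _ _ with refl ← mid-injective y≡
        with () ← trans (sym forward) backward
      through-mid (enter₁ e forward) (leave₂ _ _) y≡ x≡ z≡ with refl ← mid-injective y≡
        with refl ← vert-injective x≡ | refl ← vert-injective z≡ =
        e , refl , inj₁ (refl , refl) , e , inj₁ (refl , trans (sym (first≡d e)) forward)
      through-mid (enter₂ e _) (leave₁ _ backward) y≡ x≡ z≡ with refl ← mid-injective y≡
        with refl ← vert-injective x≡ | refl ← vert-injective z≡ =
        e , refl , inj₂ (refl , refl) , e , inj₂ (refl , trans (sym (first≡d e)) backward)

      Linked-originals : ∀ a p v → Linked (Arc DS) (vert a ∷ p ++ [ vert v ]) →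
        Linked (Arc DG) (a ∷ originals (p ++ [ vert v ]))
      Linked-originals a [] v l = ⊥-elim (SArc-vert-vert (toSArc (Linked.head l)) refl refl)
      Linked-originals a (x ∷ []) v (ax ∷ xv ∷ [-]) with vertexView x
      ... | left b  = ⊥-elim (SArc-vert-vert (toSArc ax) refl refl)
      ... | right e with _ , _ , _ , av ← through-mid (toSArc ax) (toSArc xv) refl refl refl =
        subst (λ xs → Linked (Arc DG) (a ∷ xs)) (sym (trans (originals-mid e [ vert v ]) (originals-vert v [])))
          (av ∷ [-])
      Linked-originals a (x ∷ y ∷ p) v (ax ∷ xy ∷ l) with vertexView x | vertexView y
      ... | left b  | _       = ⊥-elim (SArc-vert-vert (toSArc ax) refl refl)
      ... | right e | right f = ⊥-elim (SArc-mid-mid (toSArc xy) refl refl)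
      ... | right e | left w with _ , _ , _ , aw ← through-mid (toSArc ax) (toSArc xy) refl refl refl =
        subst (λ xs → Linked (Arc DG) (a ∷ xs))
          (sym (trans (originals-mid e (vert w ∷ p ++ [ vert v ])) (originals-vert w (p ++ [ vert v ]))))
          (aw ∷ Linked-originals w p v l)

      originals-path : ∀ u p v → originals (vert u ∷ p ++ [ vert v ]) ≡ u ∷ originals p ++ [ v ]
      originals-path u p v = trans (originals-vert u (p ++ [ vert v ]))
        (cong (u ∷_) (trans (originals-++ p [ vert v ]) (cong (originals p ++_) (originals-vert v []))))

      IsPath-originals : ∀ {u v p} → IsPath DS (vert u) (vert v) p → IsPath DG u v (originals p)
      IsPath-originals {u} {v} {p} (unique , linked) =
        subst Unique (originals-path u p v) (originals-Unique unique) ,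
        subst (λ xs → Linked (Arc DG) (u ∷ xs))
          (trans (originals-++ p [ vert v ]) (cong (originals p ++_) (originals-vert v [])))
          (Linked-originals u p v linked)

      originals≡[]⇒single-mid : ∀ {u v p} → IsPath DS (vert u) (vert v) p → originals p ≡ [] →
        ∃ λ e → p ≡ [ mid e ] × SameEdge (ends G e) (u , v)
      originals≡[]⇒single-mid {p = []} (_ , l) _ = ⊥-elim (SArc-vert-vert (toSArc (Linked.head l)) refl refl)
      originals≡[]⇒single-mid {p = x ∷ []} (_ , ux ∷ xv ∷ [-]) _ with vertexView x
      ... | left b  = ⊥-elim (SArc-vert-vert (toSArc ux) refl refl)
      ... | right e with e′ , x≡ , uv , _ ← through-mid (toSArc ux) (toSArc xv) refl refl refl =
        e′ , cong [_] x≡ , uv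
      originals≡[]⇒single-mid {p = x ∷ y ∷ p} (_ , ux ∷ xy ∷ _) p≡[] with vertexView x | vertexView y
      ... | left b  | _       = ⊥-elim (SArc-vert-vert (toSArc ux) refl refl)
      ... | right e | right f = ⊥-elim (SArc-mid-mid (toSArc xy) refl refl)
      ... | right e | left w with () ← trans (sym (trans (originals-mid e (vert w ∷ p)) (originals-vert w p))) p≡[]

      originals-separates : Simple G → ∀ {u v p q} → IsPath DS (vert u) (vert v) p → IsPath DS (vert u) (vert v) q →
        p ≢ q × Disjoint p q → originals p ≢ originals q × Disjoint (originals p) (originals q)
      originals-separates simple {p = p} {q} path-p path-q (p≢q , p∩q) = distinct , originals-Disjoint p∩q
        where
        distinct : originals p ≢ originals q
        distinct eq with originals p in p≡
        ... | a ∷ _ = originals-Disjoint p∩q (subst (a ∈_) (sym p≡) (here refl) , subst (a ∈_) eq (here refl))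
        ... | []
          with e , refl , uv  ← originals≡[]⇒single-mid path-p p≡
             | f , refl , uv′ ← originals≡[]⇒single-mid path-q (sym eq)
          = p≢q (cong (λ e → [ mid e ]) (SameEdge-unique simple uv uv′))

      IDFamily-originals : Simple G → ∀ {u v ps} → IDFamily DS (vert u) (vert v) ps → IDFamily DG u v (map originals ps)
      IDFamily-originals simple (paths , pairs) =
        Allₚ.map⁺ (All.map IsPath-originals paths) ,
        AllPairsₚ.map⁺ (AllPairs-map-All (originals-separates simple) paths pairs)

      IDFamily-vert-length≤κ : Simple G → ∀ {u v k qs} → IsKappa DG u v k → IDFamily DS (vert u) (vert v) qs →
        length qs ≤ k
      IDFamily-vert-length≤κ simple {qs = qs} (_ , maximal) family =
        subst (_≤ _) (Listₚ.length-map originals qs) (maximal (map originals qs) (IDFamily-originals simple family))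

      κ-vert≤κ : Simple G → ∀ {u v k k′} → IsKappa DS (vert u) (vert v) k → IsKappa DG u v k′ → k ≤ k′
      κ-vert≤κ simple ((_ , family , refl) , _) κ′ = IDFamily-vert-length≤κ simple κ′ family

-- The upper bound

arc? : (G : Graph) (d : Orientation G) → ∀ u v → Dec (Arc (orient G d) u v)
arc? G d u v = Finₚ.any? λ e →
  (Productₚ.≡-dec Fin._≟_ Fin._≟_ (ends G e) (u , v) ×-dec (d e Boolₚ.≟ true)) ⊎-dec
  (Productₚ.≡-dec Fin._≟_ Fin._≟_ (ends G e) (v , u) ×-dec (d e Boolₚ.≟ false))

module UpperBound (G : Graph) (simple : Simple G) (dS : Orientation (S G))
  (κS : Fin (n G + m G) → Fin (n G + m G) → ℕ)
  (κS-spec : ∀ x y → x ≢ y → IsKappa (orient (S G) dS) x y (κS x y)) where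

  open Subdivision G
  open Oriented dS
  open Projection first (λ _ → refl)

  vert-vert≤ : ∀ {κ} → (∀ u v → u ≢ v → IsKappa DG u v (κ u v)) →
    sumPairs (n G) (λ u v → κS (vert u) (vert v)) ≤ sumPairs (n G) κ
  vert-vert≤ κ-spec = sumPairs-mono-≤ (n G) λ u v u≢v →
    κ-vert≤κ simple (κS-spec (vert u) (vert v) (u≢v ∘ vert-injective)) (κ-spec u v u≢v)

  vert-mid≤ : ∑[ u < n G ] ∑[ e < m G ] κS (vert u) (mid e) + ∑[ e < m G ] ∑[ u < n G ] κS (mid e) (vert u)
            ≤ n G * (m G * 2)
  vert-mid≤ = begin
      ∑[ u < n G ] ∑[ e < m G ] to-mid u e + ∑[ e < m G ] ∑[ u < n G ] from-mid u e
    ≡⟨ cong (∑[ u < n G ] ∑[ e < m G ] to-mid u e +_) (∑-comm (flip from-mid)) ⟩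
      ∑[ u < n G ] ∑[ e < m G ] to-mid u e + ∑[ u < n G ] ∑[ e < m G ] from-mid u e
    ≡⟨ ∑∑-distrib-+ to-mid from-mid ⟨
      ∑[ u < n G ] ∑[ e < m G ] (to-mid u e + from-mid u e)
    ≤⟨ ∑-mono-≤ (n G) (λ u → ∑-mono-≤ (m G) λ e →
         subst (_≤ 2) (ℕ.+-comm (from-mid u e) _)
           (κ-mid-out+in≤2 e (κS-spec (mid e) (vert u) (vert≢mid ∘ sym)) (κS-spec (vert u) (mid e) vert≢mid))) ⟩
      ∑[ u < n G ] ∑[ e < m G ] 2
    ≡⟨ ∑∑-const (n G) (m G) (λ _ _ → refl) ⟩
      n G * (m G * 2) ∎
    where
    open ℕ.≤-Reasoning
    to-mid from-mid : Fin (n G) → Fin (m G) → ℕ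
    to-mid u e   = κS (vert u) (mid e)
    from-mid u e = κS (mid e) (vert u)

  mid-mid≤ : sumPairs (m G) (λ e f → κS (mid e) (mid f)) ≤ m G * (m G ∸ 1)
  mid-mid≤ = ℕ.*-cancelˡ-≤ 2 (begin
      2 * sumPairs (m G) κM
    ≡⟨ double (sumPairs (m G) κM) ⟩
      sumPairs (m G) κM + sumPairs (m G) κM
    ≡⟨ cong (sumPairs (m G) κM +_) (sumPairs-transpose (m G) κM) ⟩
      sumPairs (m G) κM + sumPairs (m G) (flip κM)
    ≡⟨ sym (sumPairs-+ (m G) κM (flip κM)) ⟩
      sumPairs (m G) (λ e f → κM e f + κM f e)
    ≤⟨ sumPairs-mono-≤ (m G) (λ e f e≢f → κ-mid-out+in≤2 e (κS-spec (mid e) (mid f) (e≢f ∘ mid-injective))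
                                                           (κS-spec (mid f) (mid e) (e≢f ∘ sym ∘ mid-injective))) ⟩
      sumPairs (m G) (λ _ _ → 2)
    ≡⟨ sumPairs-const (m G) 2 ⟩
      m G * ((m G ∸ 1) * 2)
    ≡⟨ rearrange (m G) (m G ∸ 1) ⟩
      2 * (m G * (m G ∸ 1)) ∎)
    where
    open ℕ.≤-Reasoning
    κM : Fin (m G) → Fin (m G) → ℕ
    κM e f = κS (mid e) (mid f)
    double : ∀ x → 2 * x ≡ x + x
    double = solve-∀
    rearrange : ∀ m k → m * (k * 2) ≡ 2 * (m * k)
    rearrange = solve-∀

  K-S≤newPairs+K : ∀ {t} → IsTotal DG t → sumPairs (n G + m G) κS ≤ newPairs (n G) (m G) + t
  K-S≤newPairs+K (κ , κ-spec , refl) = begin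
      sumPairs (n G + m G) κS
    ≡⟨ sumPairs-++ (n G) (m G) κS ⟩
      sumPairs (n G) (λ u v → κS (vert u) (vert v))
        + (∑[ u < n G ] ∑[ e < m G ] κS (vert u) (mid e) + ∑[ e < m G ] ∑[ u < n G ] κS (mid e) (vert u))
        + sumPairs (m G) (λ e f → κS (mid e) (mid f))
    ≤⟨ ℕ.+-mono-≤ (ℕ.+-mono-≤ (vert-vert≤ κ-spec) vert-mid≤) mid-mid≤ ⟩
      sumPairs (n G) κ + n G * (m G * 2) + m G * (m G ∸ 1)
    ≡⟨ rearrange (sumPairs (n G) κ) _ _ ⟩
      newPairs (n G) (m G) + sumPairs (n G) κ ∎
    where
    open ℕ.≤-Reasoning
    rearrange : ∀ a b c → a + b + c ≡ b + c + a
    rearrange = solve-∀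

-- The lower bound

subdivide : (G : Graph) → Orientation G → Orientation (S G)
subdivide G d i = [ d , not ∘ d ]′ (Fin.splitAt (m G) i)

module LowerBound (G : Graph) (d : Orientation G) where

  open Subdivision G
  open Oriented (subdivide G d)

  first≡d : ∀ e → first e ≡ d e
  first≡d e rewrite Finₚ.splitAt-↑ˡ (m G) e (m G) = refl

  second≡not-d : ∀ e → second e ≡ not (d e)
  second≡not-d e rewrite Finₚ.splitAt-↑ʳ (m G) (m G) e = refl

  open Projection d first≡d

  tail head : Fin (m G) → Fin (n G)
  tail e = if d e then end₁ e else end₂ e
  head e = if d e then end₂ e else end₁ e

  arc-tail : ∀ e → Arc DS (vert (tail e)) (mid e)
  arc-tail e with d e in de
  ... | true  = fromSArc (enter₁ e (trans (first≡d e) de))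
  ... | false = fromSArc (enter₂ e (trans (second≡not-d e) (cong not de)))

  arc-head : ∀ e → Arc DS (mid e) (vert (head e))
  arc-head e with d e in de
  ... | true  = fromSArc (leave₂ e (trans (second≡not-d e) (cong not de)))
  ... | false = fromSArc (leave₁ e (trans (first≡d e) de))

  OrientedAs : Fin (n G) → Fin (n G) → Fin (m G) → Set
  OrientedAs a w e = (ends G e ≡ (a , w) × d e ≡ true) ⊎ (ends G e ≡ (w , a) × d e ≡ false)

  OrientedAs⇒tail-head : ∀ {a w e} → OrientedAs a w e → a ≡ tail e × w ≡ head e
  OrientedAs⇒tail-head {e = e} (inj₁ (refl , de)) rewrite de = refl , refl
  OrientedAs⇒tail-head {e = e} (inj₂ (refl , de)) rewrite de = refl , refl

  liftInner : ∀ a zs v → Linked (Arc DG) (a ∷ zs ++ [ v ]) → List Vertex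
  liftInner a []       v ((e , _) ∷ [-]) = [ mid e ]
  liftInner a (b ∷ zs) v ((e , _) ∷ l)   = mid e ∷ vert b ∷ liftInner b zs v l

  Linked-lift : ∀ a zs v (l : Linked (Arc DG) (a ∷ zs ++ [ v ])) →
    Linked (Arc DS) (vert a ∷ liftInner a zs v l ++ [ vert v ])
  Linked-lift a []       v ((e , ae) ∷ [-]) with refl , refl ← OrientedAs⇒tail-head ae =
    arc-tail e ∷ arc-head e ∷ [-]
  Linked-lift a (b ∷ zs) v ((e , ae) ∷ l)   with refl , refl ← OrientedAs⇒tail-head ae =
    arc-tail e ∷ arc-head e ∷ Linked-lift b zs v l

  originals-lift : ∀ a zs v (l : Linked (Arc DG) (a ∷ zs ++ [ v ])) → originals (liftInner a zs v l) ≡ zs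
  originals-lift a []       v ((e , _) ∷ [-]) = originals-mid e []
  originals-lift a (b ∷ zs) v ((e , _) ∷ l)   =
    trans (originals-mid e (vert b ∷ liftInner b zs v l))
      (trans (originals-vert b (liftInner b zs v l)) (cong (b ∷_) (originals-lift b zs v l)))

  ∈-lift⁻ : ∀ a zs v (l : Linked (Arc DG) (a ∷ zs ++ [ v ])) {x} → x ∈ liftInner a zs v l →
    (∃ λ w → x ≡ vert w × w ∈ zs) ⊎
    (∃ λ e → x ≡ mid e × ((tail e ≡ a × head e ≡ secondVertex zs v) ⊎ tail e ∈ zs))
  ∈-lift⁻ a []       v ((e , ae) ∷ [-]) (here refl) with refl , refl ← OrientedAs⇒tail-head ae =
    inj₂ (e , refl , inj₁ (refl , refl))
  ∈-lift⁻ a (b ∷ zs) v ((e , ae) ∷ l)   (here refl) with refl , refl ← OrientedAs⇒tail-head ae =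
    inj₂ (e , refl , inj₁ (refl , refl))
  ∈-lift⁻ a (b ∷ zs) v (_ ∷ l) (there (here refl)) = inj₁ (b , refl , here refl)
  ∈-lift⁻ a (b ∷ zs) v (_ ∷ l) (there (there x∈)) with ∈-lift⁻ b zs v l x∈
  ... | inj₁ (w , x≡ , w∈)                = inj₁ (w , x≡ , there w∈)
  ... | inj₂ (f , x≡ , inj₁ (tail≡b , _)) = inj₂ (f , x≡ , inj₂ (subst (_∈ b ∷ zs) (sym tail≡b) (here refl)))
  ... | inj₂ (f , x≡ , inj₂ tail∈)        = inj₂ (f , x≡ , inj₂ (there tail∈))

  originals-lifted-path : ∀ a zs v (l : Linked (Arc DG) (a ∷ zs ++ [ v ])) →
    originals (vert a ∷ liftInner a zs v l ++ [ vert v ]) ≡ a ∷ zs ++ [ v ]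
  originals-lifted-path a zs v l =
    trans (originals-path a (liftInner a zs v l) v) (cong (λ xs → a ∷ xs ++ [ v ]) (originals-lift a zs v l))

  Unique-lift : ∀ a zs v (l : Linked (Arc DG) (a ∷ zs ++ [ v ])) → Unique (a ∷ zs ++ [ v ]) →
    Unique (vert a ∷ liftInner a zs v l ++ [ vert v ])
  Unique-lift a [] v ((e , _) ∷ [-]) ((a≢v ∷ []) ∷ _) =
    (vert≢mid ∷ (a≢v ∘ vert-injective) ∷ []) ∷ ((vert≢mid ∘ sym) ∷ []) ∷ [] ∷ []
  Unique-lift a (b ∷ zs) v ((e , ae) ∷ l) (a∉ ∷ unique) =
    (vert≢mid ∷ All.tabulate (λ x∈ vert-a≡x → a∉rest (subst (_∈ _) (sym vert-a≡x) x∈)))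
    ∷ All.tabulate (λ x∈ mid-e≡x → mid-e∉rest (subst (_∈ _) (sym mid-e≡x) x∈))
    ∷ Unique-lift b zs v l unique
    where
    rest : List Vertex
    rest = vert b ∷ liftInner b zs v l ++ [ vert v ]
    a∉rest : vert a ∉ rest
    a∉rest a∈ = All≢⇒∉ a∉ (subst (a ∈_) (originals-lifted-path b zs v l) (∈-originals⁺ rest a∈))
    a≡tail : a ≡ tail e
    a≡tail = proj₁ (OrientedAs⇒tail-head ae)
    mid-e∉rest : mid e ∉ rest
    mid-e∉rest (here e≡b)  = vert≢mid (sym e≡b)
    mid-e∉rest (there e∈) with ∈-++⁻ (liftInner b zs v l) e∈
    ... | inj₂ (here e≡v) = vert≢mid (sym e≡v)
    ... | inj₁ e∈lift with ∈-lift⁻ b zs v l e∈lift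
    ...   | inj₁ (_ , e≡w , _) = vert≢mid (sym e≡w)
    ...   | inj₂ (f , e≡f , tail-f) with refl ← mid-injective e≡f with tail-f
    ...     | inj₁ (tail≡b , _) = All≢⇒∉ a∉ (here (trans a≡tail tail≡b))
    ...     | inj₂ tail∈zs      = All≢⇒∉ a∉ (there (∈-++⁺ˡ (subst (_∈ zs) (sym a≡tail) tail∈zs)))

  liftPath : ∀ {u v} p → IsPath DG u v p → List Vertex
  liftPath {u} {v} p (_ , linked) = liftInner u p v linked

  IsPath-liftPath : ∀ {u v} p (path : IsPath DG u v p) → IsPath DS (vert u) (vert v) (liftPath p path)
  IsPath-liftPath {u} {v} p (unique , linked) = Unique-lift u p v linked unique , Linked-lift u p v linked

  liftPath-separates : ∀ {u v} p q (path-p : IsPath DG u v p) (path-q : IsPath DG u v q) → p ≢ q × Disjoint p q →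
    liftPath p path-p ≢ liftPath q path-q × Disjoint (liftPath p path-p) (liftPath q path-q)
  liftPath-separates {u} {v} p q path-p path-q (p≢q , p∩q) = distinct , disjoint
    where
    distinct : liftPath p path-p ≢ liftPath q path-q
    distinct eq = p≢q (trans (sym (originals-lift u p v (proj₂ path-p)))
                      (trans (cong originals eq) (originals-lift u q v (proj₂ path-q))))
    u∉ : ∀ {r} → IsPath DG u v r → u ∉ r
    u∉ ((u∉r ∷ _) , _) u∈ = All≢⇒∉ u∉r (∈-++⁺ˡ u∈)
    disjoint : Disjoint (liftPath p path-p) (liftPath q path-q)
    disjoint (x∈p , x∈q) with ∈-lift⁻ u p v (proj₂ path-p) x∈p | ∈-lift⁻ u q v (proj₂ path-q) x∈q
    ... | inj₁ (w , refl , w∈p) | inj₁ (w′ , x≡ , w′∈q) =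
      p∩q (w∈p , subst (_∈ q) (sym (vert-injective x≡)) w′∈q)
    ... | inj₁ (w , refl , _)   | inj₂ (f , x≡ , _)     = vert≢mid x≡
    ... | inj₂ (f , refl , _)   | inj₁ (w , x≡ , _)     = vert≢mid (sym x≡)
    ... | inj₂ (f , refl , in-p) | inj₂ (f′ , x≡ , in-q) with refl ← mid-injective x≡ with in-p | in-q
    ...   | inj₂ tail∈p         | inj₂ tail∈q         = p∩q (tail∈p , tail∈q)
    ...   | inj₂ tail∈p         | inj₁ (tail≡u , _)   = u∉ path-p (subst (_∈ p) tail≡u tail∈p)
    ...   | inj₁ (tail≡u , _)   | inj₂ tail∈q         = u∉ path-q (subst (_∈ q) tail≡u tail∈q)
    ...   | inj₁ (_ , head≡p₂)  | inj₁ (_ , head≡q₂)  =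
      secondVertex-injective DG p q path-p path-q (p≢q , p∩q) (trans (sym head≡p₂) head≡q₂)

  liftFamily : ∀ {u v} ps → All (IsPath DG u v) ps → List (List Vertex)
  liftFamily []       []                = []
  liftFamily (p ∷ ps) (path ∷ paths) = liftPath p path ∷ liftFamily ps paths

  length-liftFamily : ∀ {u v} ps (paths : All (IsPath DG u v) ps) → length (liftFamily ps paths) ≡ length ps
  length-liftFamily []       []             = refl
  length-liftFamily (p ∷ ps) (path ∷ paths) = cong suc (length-liftFamily ps paths)

  IDFamily-lift : ∀ {u v} ps (paths : All (IsPath DG u v) ps) → AllPairs (λ p q → p ≢ q × Disjoint p q) ps →
    IDFamily DS (vert u) (vert v) (liftFamily ps paths)
  IDFamily-lift []       []             []             = [] , []
  IDFamily-lift (p ∷ ps) (path ∷ paths) (sep ∷ seps) with paths′ , seps′ ← IDFamily-lift ps paths seps =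
    (IsPath-liftPath p path ∷ paths′) , (separated ps paths sep ∷ seps′)
    where
    separated : ∀ qs (paths-q : All (IsPath DG _ _) qs) → All (λ q → p ≢ q × Disjoint p q) qs →
      All (λ q′ → liftPath p path ≢ q′ × Disjoint (liftPath p path) q′) (liftFamily qs paths-q)
    separated []       []                 []           = []
    separated (q ∷ qs) (path-q ∷ paths-q) (s ∷ sep-q) = liftPath-separates p q path path-q s ∷ separated qs paths-q sep-q

  κ-vert : ∀ {u v k} → Simple G → IsKappa DG u v k → IsKappa DS (vert u) (vert v) k
  κ-vert simple κ@((ps , (paths , seps) , refl) , _) =
    (liftFamily ps paths , IDFamily-lift ps paths seps , length-liftFamily ps paths) ,
    λ qs → IDFamily-vert-length≤κ simple κ

  length-outNeighbours : ∀ e → length (outNeighbours e) ≡ 1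
  length-outNeighbours e rewrite first≡d e | second≡not-d e with d e
  ... | true  = refl
  ... | false = refl

  length-inNeighbours : ∀ e → length (inNeighbours e) ≡ 1
  length-inNeighbours e rewrite first≡d e | second≡not-d e with d e
  ... | true  = refl
  ... | false = refl

  κ-from-mid : ∀ e {y p} → IsPath DS (mid e) y p → IsKappa DS (mid e) y 1
  κ-from-mid e {p = p} path =
    ([ p ] , ((path ∷ []) , ([] ∷ [])) , refl) ,
    λ ps family → subst (_ ≤_) (length-outNeighbours e) (IDFamily-from-mid e family)

  κ-to-mid : ∀ e {y p} → IsPath DS y (mid e) p → IsKappa DS y (mid e) 1
  κ-to-mid e {p = p} path =
    ([ p ] , ((path ∷ []) , ([] ∷ [])) , refl) ,
    λ ps family → subst (_ ≤_) (length-inNeighbours e) (IDFamily-to-mid e family)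

  path-vert-vert : Strong DG → ∀ {u v} → u ≢ v → ∃ (IsPath DS (vert u) (vert v))
  path-vert-vert strong u≢v with p , path ← strong _ _ u≢v = liftPath p path , IsPath-liftPath p path

  path-vert-mid : Strong DG → ∀ u e → ∃ (IsPath DS (vert u) (mid e))
  path-vert-mid strong u e with u Fin.≟ tail e
  ... | yes refl = [] , IsPath-arc DS irreflexive (arc-tail e)
  ... | no  u≢t  = IsPath-extendʳ DS irreflexive (proj₂ (path-vert-vert strong u≢t)) (arc-tail e) vert≢mid

  path-mid-vert : Strong DG → ∀ e v → ∃ (IsPath DS (mid e) (vert v))
  path-mid-vert strong e v with head e Fin.≟ v
  ... | yes refl = [] , IsPath-arc DS irreflexive (arc-head e)
  ... | no  h≢v  = IsPath-extendˡ DS irreflexive (arc-head e) (proj₂ (path-vert-vert strong h≢v)) (vert≢mid ∘ sym)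

  path-mid-mid : Strong DG → ∀ {e f} → e ≢ f → ∃ (IsPath DS (mid e) (mid f))
  path-mid-mid strong {e} {f} e≢f =
    IsPath-extendʳ DS irreflexive (proj₂ (path-mid-vert strong e (tail f))) (arc-tail f) (e≢f ∘ mid-injective)

  κS : (Fin (n G) → Fin (n G) → ℕ) → Vertex → Vertex → ℕ
  κS κ x y = [ (λ u → [ κ u , (λ _ → 1) ]′ (Fin.splitAt (n G) y)) , (λ _ → 1) ]′ (Fin.splitAt (n G) x)

  κS-vert-vert : ∀ κ u v → κS κ (vert u) (vert v) ≡ κ u v
  κS-vert-vert κ u v rewrite Finₚ.splitAt-↑ˡ (n G) u (m G) | Finₚ.splitAt-↑ˡ (n G) v (m G) = refl

  κS-vert-mid : ∀ κ u e → κS κ (vert u) (mid e) ≡ 1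
  κS-vert-mid κ u e rewrite Finₚ.splitAt-↑ˡ (n G) u (m G) | Finₚ.splitAt-↑ʳ (n G) (m G) e = refl

  κS-mid : ∀ κ e y → κS κ (mid e) y ≡ 1
  κS-mid κ e y rewrite Finₚ.splitAt-↑ʳ (n G) (m G) e = refl

  κS-spec : Simple G → Strong DG → ∀ {κ} → (∀ u v → u ≢ v → IsKappa DG u v (κ u v)) →
    ∀ x y → x ≢ y → IsKappa DS x y (κS κ x y)
  κS-spec simple strong {κ} κ-spec x y x≢y with vertexView x | vertexView y
  ... | left u  | left v  = subst (IsKappa DS (vert u) (vert v)) (sym (κS-vert-vert κ u v))
                              (κ-vert simple (κ-spec u v (x≢y ∘ cong vert)))
  ... | left u  | right e = subst (IsKappa DS (vert u) (mid e)) (sym (κS-vert-mid κ u e))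
                              (κ-to-mid e (proj₂ (path-vert-mid strong u e)))
  ... | right e | left v  = subst (IsKappa DS (mid e) (vert v)) (sym (κS-mid κ e (vert v)))
                              (κ-from-mid e (proj₂ (path-mid-vert strong e v)))
  ... | right e | right f = subst (IsKappa DS (mid e) (mid f)) (sym (κS-mid κ e (mid f)))
                              (κ-from-mid e (proj₂ (path-mid-mid strong (x≢y ∘ cong mid))))

  sumPairs-κS : ∀ κ → sumPairs (n G + m G) (κS κ) ≡ newPairs (n G) (m G) + sumPairs (n G) κ
  sumPairs-κS κ = begin
      sumPairs (n G + m G) (κS κ)
    ≡⟨ sumPairs-++ (n G) (m G) (κS κ) ⟩
      sumPairs (n G) (λ u v → κS κ (vert u) (vert v))
        + (∑[ u < n G ] ∑[ e < m G ] κS κ (vert u) (mid e) + ∑[ e < m G ] ∑[ u < n G ] κS κ (mid e) (vert u))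
        + sumPairs (m G) (λ e f → κS κ (mid e) (mid f))
    ≡⟨ cong₂ _+_ (cong₂ _+_ (sumPairs-cong (n G) λ u v _ → κS-vert-vert κ u v)
                            (cong₂ _+_ (∑∑-const (n G) (m G) (κS-vert-mid κ))
                                       (∑∑-const (m G) (n G) λ e u → κS-mid κ e (vert u))))
                 (trans (sumPairs-cong (m G) λ e f _ → κS-mid κ e (mid f)) (sumPairs-const (m G) 1)) ⟩
      sumPairs (n G) κ + (n G * (m G * 1) + m G * (n G * 1)) + m G * ((m G ∸ 1) * 1)
    ≡⟨ rearrange (sumPairs (n G) κ) (n G) (m G) (m G ∸ 1) ⟩
      newPairs (n G) (m G) + sumPairs (n G) κ ∎
    where
    open ≡-Reasoning
    rearrange : ∀ t n m k → t + (n * (m * 1) + m * (n * 1)) + m * (k * 1) ≡ (n * (m * 2) + m * k) + t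
    rearrange = solve-∀

  IsTotal-subdivide : Simple G → Strong DG → ∀ {t} → IsTotal DG t → IsTotal DS (newPairs (n G) (m G) + t)
  IsTotal-subdivide simple strong (κ , κ-spec , refl) = κS κ , κS-spec simple strong κ-spec , sym (sumPairs-κS κ)

Kmax-S≤ : (G : Graph) → Simple G → ∀ {a b} → IsKmax (S G) a → IsKmax G b → a ≤ newPairs (n G) (m G) + b
Kmax-S≤ G simple (dS , (κS , κS-spec , refl) , _) (_ , _ , G-optimal) =
  let t , total = total-exists (orient G d) (arc? G d)
  in ℕ.≤-trans (K-S≤newPairs+K total) (ℕ.+-monoʳ-≤ (newPairs (n G) (m G)) (G-optimal d t total))
  where
  open UpperBound G simple dS κS κS-spec
  d : Orientation G
  d = Subdivision.Oriented.first G dS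

Kmax-S≥ : (G : Graph) → Simple G → ∀ {a b} → IsKmax (S G) a → IsKmax G b →
  ∃[ d ] (Optimal G d × Strong (orient G d)) → newPairs (n G) (m G) + b ≤ a
Kmax-S≥ G simple (_ , _ , S-optimal) (dG , G-total , _) (d , (_ , d-total , d-optimal) , strong) =
  ℕ.≤-trans (ℕ.+-monoʳ-≤ (newPairs (n G) (m G)) (d-optimal dG _ G-total))
            (S-optimal (subdivide G d) _ (LowerBound.IsTotal-subdivide G d simple strong d-total))

lemma4p9 : (G : Graph) → Simple G → (a b : ℕ) → IsKmax (S G) a → IsKmax G b →
    (a ≤ 2 * (((n G + m G) C 2) ∸ (n G C 2)) + b)
    × ((∃[ d ] (Optimal G d × Strong (orient G d))) →
       a ≡ 2 * (((n G + m G) C 2) ∸ (n G C 2)) + b)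
lemma4p9 G simple a b Kmax-S Kmax-G rewrite 2*[[n+m]C2∸nC2]≡newPairs (n G) (m G) =
  Kmax-S≤ G simple Kmax-S Kmax-G ,
  λ strong-optimal → ℕ.≤-antisym (Kmax-S≤ G simple Kmax-S Kmax-G) (Kmax-S≥ G simple Kmax-S Kmax-G strong-optimal)
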